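{- Let $K$ be a field, $d,n>1$ integers, $V=K^n$, $N=\binom{d+n-1}{d}$, and $v_d\colon V\to K^N$ the Veronese map. If $z\in V$ is a vector lying in none of the $d$ subspaces $U_1,\dots,U_d$ of $V$, then $v_d(z)\notin\langle v_d(U_1),\dots,v_d(U_d)\rangle$.
   Context: Fix an arbitrary ordering of all sequences $\alpha=(a_1,\dots,a_n)$ of nonnegative integers with $\sum_k a_k=d$; coordinates of $K^N$ are indexed by them. For $t\in K^n$, $t^\alpha=\prod_i t_i^{a_i}$ and $v_d(t)=(t^\alpha)_\alpha$. For a subspace $U$, $v_d(U)=\{v_d(u)\mid u\in U\}$, and $\langle\cdots\rangle$ denotes linear span. -}

module Defs where

open import Level using (Level; _⊔_) renaming (suc to lsuc)
open import Data.Nat as ℕ using (ℕ)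
open import Data.Fin using (Fin; zero; suc)
open import Data.Product using (Σ; ∃; _×_; _,_; proj₂)
open import Data.List using (List; []; _∷_)
open import Data.List.Relation.Unary.All using (All)
open import Relation.Nullary using (¬_)
open import Relation.Binary.PropositionalEquality using (_≡_)
open import Algebra.Bundles using (CommutativeRing)

record Field (c ℓ : Level) : Set (lsuc (c ⊔ ℓ)) where
  field
    commutativeRing : CommutativeRing c ℓ
  open CommutativeRing commutativeRing public
  field
    1≉0     : ¬ (1# ≈ 0#)
    inverse : ∀ x → ¬ (x ≈ 0#) → ∃ λ y → (x * y) ≈ 1#

sumℕ : ∀ {n} → (Fin n → ℕ) → ℕ
sumℕ {ℕ.zero}  a = 0
sumℕ {ℕ.suc n} a = a zero ℕ.+ sumℕ (λ i → a (suc i))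

-- exponent sequences α = (a_1,…,a_n) with ∑ a_k = d; these index the
-- coordinates of K^N (N = binom(d+n-1, d)); the order is immaterial.
Multi : ℕ → ℕ → Set
Multi n d = Σ (Fin n → ℕ) (λ a → sumℕ a ≡ d)

module _ {c ℓ : Level} (K : Field c ℓ) where
  open Field K using (Carrier; _≈_; _+_; _*_; 0#; 1#)

  Vecᴷ : ℕ → Set c
  Vecᴷ n = Fin n → Carrier

  _≈ᵛ_ : ∀ {n} → Vecᴷ n → Vecᴷ n → Set ℓ
  u ≈ᵛ v = ∀ i → u i ≈ v i

  VecN : ℕ → ℕ → Set c
  VecN n d = Multi n d → Carrier

  _≈ᴺ_ : ∀ {n d} → VecN n d → VecN n d → Set ℓ
  u ≈ᴺ v = ∀ α → u α ≈ v α

  record Subspace (p : Level) (n : ℕ) : Set (c ⊔ ℓ ⊔ lsuc p) where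
    field
      _∈U   : Vecᴷ n → Set p
      resp  : ∀ {u v} → u ≈ᵛ v → u ∈U → v ∈U
      zero∈ : (λ _ → 0#) ∈U
      +∈    : ∀ {u v} → u ∈U → v ∈U → (λ i → u i + v i) ∈U
      *∈    : ∀ a {u} → u ∈U → (λ i → a * u i) ∈U

  pow : Carrier → ℕ → Carrier
  pow x ℕ.zero    = 1#
  pow x (ℕ.suc k) = x * pow x k

  prod : ∀ {n} → (Fin n → Carrier) → Carrier
  prod {ℕ.zero}  f = 1#
  prod {ℕ.suc n} f = f zero * prod (λ i → f (suc i))

  monomial : ∀ {n d} → Vecᴷ n → Multi n d → Carrier
  monomial t (a , _) = prod (λ i → pow (t i) (a i))

  veronese : ∀ {n} (d : ℕ) → Vecᴷ n → VecN n d
  veronese d t α = monomial t α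

  VeroneseImage : ∀ {p n} (d : ℕ) → Subspace p n → VecN n d → Set (c ⊔ ℓ ⊔ p)
  VeroneseImage d U w = ∃ λ u → (u ∈U) × (w ≈ᴺ veronese d u)
    where open Subspace U

  linComb : ∀ {n d} → List (Carrier × VecN n d) → VecN n d
  linComb []             α = 0#
  linComb ((a , w) ∷ cs) α = a * w α + linComb cs α

  InSpan : ∀ {q n d} → (VecN n d → Set q) → VecN n d → Set (c ⊔ ℓ ⊔ q)
  InSpan {n = n} {d = d} S w = ∃ λ (cs : List (Carrier × VecN n d)) →
                 All (λ cw → S (proj₂ cw)) cs × (w ≈ᴺ linComb cs)

module Submission where

open import Defs
open import Level using (Level)
open import Data.Nat using (ℕ; _≤_)
open import Data.Fin using (Fin)
open import Data.Product using (∃)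
open import Relation.Nullary using (¬_)

open import Level using (_⊔_)
import Data.Nat as ℕ
open import Data.Nat.Properties using (+-suc; suc-injective)
open import Data.Fin using (zero; suc; _≟_)
open import Data.Fin.Properties using (sequence; all?; ¬∀⟶∃¬)
open import Data.Vec.Functional using (tail) renaming (_∷_ to _∷ᵛ_)
open import Data.Product using (Σ; _×_; _,_; proj₁; proj₂)
open import Data.Sum using (_⊎_; inj₁; inj₂)
open import Data.Empty using (⊥-elim)
open import Data.List using (List; []; _∷_; map; length)
open import Data.List.Properties using (length-map)
open import Data.List.Relation.Unary.All as All using (All; []; _∷_)
open import Data.List.Relation.Unary.All.Properties using (map⁺; map⁻)
open import Function using (_∘_)
open import Effect.Monad using (RawMonad)
open import Relation.Nullary using (Dec; yes; no)
open import Relation.Nullary.Negation using (¬¬-Monad; ¬¬-map; negated-stable)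
open import Relation.Nullary.Decidable using (¬¬-excluded-middle)
open import Relation.Binary.PropositionalEquality as ≡ using (_≡_; subst)
open import Algebra.Bundles using (CommutativeRing)
import Algebra.Properties.CommutativeSemigroup as CommutativeSemigroupProperties
import Algebra.Properties.Semiring.Sum as SemiringSum
import Algebra.Properties.Ring as RingProperties
import Algebra.Properties.AbelianGroup as AbelianGroupProperties
import Relation.Binary.Reasoning.Setoid as SetoidReasoning

-- Suppose v_d(z) = Σ_k a_k w_k with w_k = v_d(u_k) and u_k ∈ U_{i_k}.
-- Since the goal is ⊥ we may argue classically, i.e. in the double-negation
-- monad.  For each i the finitely many u_k lying in U_i span a subspace of
-- U_i not containing z, so Gaussian elimination yields a linear form ψ_i
-- vanishing on them with ψ_i(z) = 1 (the separation lemma).  The degree-d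
-- polynomial ∏_i ψ_i is a linear form Φ on K^N composed with v_d
-- (Φ(v_d(x)) = ∏_i ψ_i(x)).  Φ vanishes on every w_k, hence on v_d(z), while
-- Φ(v_d(z)) = ∏_i ψ_i(z) = 1: contradiction.

sumℕ-zeros : ∀ n → sumℕ {n} (λ _ → 0) ≡ 0
sumℕ-zeros ℕ.zero    = ≡.refl
sumℕ-zeros (ℕ.suc n) = sumℕ-zeros n

zeroExponent : ∀ {n} → Multi n 0
zeroExponent {n} = (λ _ → 0) , sumℕ-zeros n

raiseAt : ∀ {n} → Fin n → (Fin n → ℕ) → Fin n → ℕ
raiseAt zero    a zero    = ℕ.suc (a zero)
raiseAt zero    a (suc i) = a (suc i)
raiseAt (suc j) a zero    = a zero
raiseAt (suc j) a (suc i) = raiseAt j (tail a) i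

raiseAt-sum : ∀ {n} (j : Fin n) a → sumℕ (raiseAt j a) ≡ ℕ.suc (sumℕ a)
raiseAt-sum zero    a = ≡.refl
raiseAt-sum (suc j) a = ≡.trans (≡.cong (a zero ℕ.+_) (raiseAt-sum j (tail a))) (+-suc (a zero) _)

raise : ∀ {n d} → Fin n → Multi n d → Multi n (ℕ.suc d)
raise j (a , Σa≡d) = raiseAt j a , ≡.trans (raiseAt-sum j a) (≡.cong ℕ.suc Σa≡d)

-- Bind of the double-negation monad with independent universe levels
-- (the library's monad instance is level-homogeneous).
bind¬¬ : ∀ {a b} {A : Set a} {B : Set b} → ¬ ¬ A → (A → ¬ ¬ B) → ¬ ¬ B
bind¬¬ x f = negated-stable (¬¬-map f x)

sequence¬¬ : ∀ {a d} {P : Fin d → Set a} → (∀ i → ¬ ¬ P i) → ¬ ¬ (∀ i → P i)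
sequence¬¬ = sequence (RawMonad.rawApplicative ¬¬-Monad)

-- Commutative-ring identities behind Gaussian elimination x ↦ x - (x_j c) u:
-- additivity, homogeneity, recovering x, and killing the pivot vector.
module EliminationIdentities {c ℓ} (R : CommutativeRing c ℓ) where
  open CommutativeRing R
  open SetoidReasoning setoid
  open RingProperties ring using (-‿distribˡ-*; -‿distribʳ-*)
  open AbelianGroupProperties +-abelianGroup using (⁻¹-∙-comm)
  open CommutativeSemigroupProperties +-commutativeSemigroup using (interchange)

  elim-+ : ∀ a b s t c u →
           (a + b) + (- ((s + t) * c)) * u ≈ (a + (- (s * c)) * u) + (b + (- (t * c)) * u)
  elim-+ a b s t c u = begin
    (a + b) + (- ((s + t) * c)) * u                ≈⟨ +-congˡ (*-congʳ (-‿cong (distribʳ c s t))) ⟩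
    (a + b) + (- (s * c + t * c)) * u              ≈⟨ +-congˡ (*-congʳ (⁻¹-∙-comm _ _)) ⟨
    (a + b) + (- (s * c) + - (t * c)) * u          ≈⟨ +-congˡ (distribʳ u _ _) ⟩
    (a + b) + ((- (s * c)) * u + (- (t * c)) * u)  ≈⟨ interchange a b _ _ ⟩
    (a + (- (s * c)) * u) + (b + (- (t * c)) * u)  ∎

  elim-* : ∀ a x s c u → a * x + (- ((a * s) * c)) * u ≈ a * (x + (- (s * c)) * u)
  elim-* a x s c u = begin
    a * x + (- ((a * s) * c)) * u   ≈⟨ +-congˡ (*-congʳ (-‿cong (*-assoc a s c))) ⟩
    a * x + (- (a * (s * c))) * u   ≈⟨ +-congˡ (*-congʳ (-‿distribʳ-* a _)) ⟩
    a * x + (a * - (s * c)) * u     ≈⟨ +-congˡ (*-assoc a _ u) ⟩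
    a * x + a * ((- (s * c)) * u)   ≈⟨ distribˡ a x _ ⟨
    a * (x + (- (s * c)) * u)       ∎

  elim-restore : ∀ x t u → x ≈ (x + (- t) * u) + t * u
  elim-restore x t u = sym (begin
    (x + (- t) * u) + t * u  ≈⟨ +-assoc x _ _ ⟩
    x + ((- t) * u + t * u)  ≈⟨ +-congˡ (distribʳ u (- t) t) ⟨
    x + (- t + t) * u        ≈⟨ +-congˡ (*-congʳ (-‿inverseˡ t)) ⟩
    x + 0# * u               ≈⟨ +-congˡ (zeroˡ u) ⟩
    x + 0#                   ≈⟨ +-identityʳ x ⟩
    x                        ∎)

  elim-self : ∀ x → x + (- 1#) * x ≈ 0#
  elim-self x = begin
    x + (- 1#) * x  ≈⟨ +-congˡ (-‿distribˡ-* 1# x) ⟨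
    x + - (1# * x)  ≈⟨ +-congˡ (-‿cong (*-identityˡ x)) ⟩
    x + - x         ≈⟨ -‿inverseʳ x ⟩
    0#              ∎

module LinearAlgebra {c ℓ : Level} (K : Field c ℓ) where
  open Field K hiding (zero)
  open SetoidReasoning setoid
  open SemiringSum semiring using (sum; sum-cong-≋; ∑-distrib-+; *-distribˡ-sum; *-distribʳ-sum)
  open CommutativeSemigroupProperties *-commutativeSemigroup using (x∙yz≈y∙xz)
  open EliminationIdentities commutativeRing

  Vect : Set → Set c
  Vect I = I → Carrier

  _≋_ : ∀ {I} → Vect I → Vect I → Set ℓ
  x ≋ y = ∀ i → x i ≈ y i

  _⊕_ : ∀ {I} → Vect I → Vect I → Vect I
  (x ⊕ y) i = x i + y i

  _⊛_ : ∀ {I} → Carrier → Vect I → Vect I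
  (a ⊛ x) i = a * x i

  0ᵛ : ∀ {I} → Vect I
  0ᵛ _ = 0#

  record Form (I : Set) : Set (c ⊔ ℓ) where
    field
      eval      : Vect I → Carrier
      eval-cong : ∀ {x y} → x ≋ y → eval x ≈ eval y
      eval-+    : ∀ x y → eval (x ⊕ y) ≈ eval x + eval y
      eval-*    : ∀ a x → eval (a ⊛ x) ≈ a * eval x
  open Form

  eval-0 : ∀ {I} (φ : Form I) → eval φ 0ᵛ ≈ 0#
  eval-0 φ = begin
    eval φ 0ᵛ          ≈⟨ eval-cong φ (λ _ → sym (zeroˡ 0#)) ⟩
    eval φ (0# ⊛ 0ᵛ)   ≈⟨ eval-* φ 0# 0ᵛ ⟩
    0# * eval φ 0ᵛ     ≈⟨ zeroˡ _ ⟩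
    0#                 ∎

  record IsLinear {I J : Set} (T : Vect J → Vect I) : Set (c ⊔ ℓ) where
    field
      map-cong : ∀ {x y} → x ≋ y → T x ≋ T y
      map-+    : ∀ x y → T (x ⊕ y) ≋ (T x ⊕ T y)
      map-*    : ∀ a x → T (a ⊛ x) ≋ (a ⊛ T x)

  pullback : ∀ {I J} (T : Vect J → Vect I) → IsLinear T → Form I → Form J
  pullback T lin φ = record
    { eval      = eval φ ∘ T
    ; eval-cong = eval-cong φ ∘ map-cong
    ; eval-+    = λ x y → trans (eval-cong φ (map-+ x y)) (eval-+ φ (T x) (T y))
    ; eval-*    = λ a x → trans (eval-cong φ (map-* a x)) (eval-* φ a (T x))
    }
    where open IsLinear lin

  reindex-linear : ∀ {I J} (h : J → I) → IsLinear (λ (w : Vect I) → w ∘ h)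
  reindex-linear h = record
    { map-cong = λ eq → eq ∘ h ; map-+ = λ _ _ _ → refl ; map-* = λ _ _ _ → refl }

  coordinate : ∀ {I} → I → Form I
  coordinate i = record
    { eval = λ x → x i ; eval-cong = λ eq → eq i ; eval-+ = λ _ _ → refl ; eval-* = λ _ _ → refl }

  _•_ : ∀ {I} → Carrier → Form I → Form I
  a • φ = record
    { eval      = λ x → a * eval φ x
    ; eval-cong = λ eq → *-congˡ (eval-cong φ eq)
    ; eval-+    = λ x y → trans (*-congˡ (eval-+ φ x y)) (distribˡ a _ _)
    ; eval-*    = λ b x → trans (*-congˡ (eval-* φ b x)) (x∙yz≈y∙xz a b _)
    }

  ∑ᶠ : ∀ {I m} → (Fin m → Form I) → Form I
  ∑ᶠ φs = record
    { eval      = λ x → sum (λ j → eval (φs j) x)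
    ; eval-cong = λ eq → sum-cong-≋ (λ j → eval-cong (φs j) eq)
    ; eval-+    = λ x y → trans (sum-cong-≋ (λ j → eval-+ (φs j) x y))
                                (∑-distrib-+ (λ j → eval (φs j) x) (λ j → eval (φs j) y))
    ; eval-*    = λ a x → trans (sum-cong-≋ (λ j → eval-* (φs j) a x))
                                (sym (*-distribˡ-sum a (λ j → eval (φs j) x)))
    }

  vanishes-on-linComb : ∀ {n d} (φ : Form (Multi n d)) (cs : List (Carrier × VecN K n d)) →
                        All (λ cw → eval φ (proj₂ cw) ≈ 0#) cs → eval φ (linComb K cs) ≈ 0#
  vanishes-on-linComb φ []             []           = eval-0 φ
  vanishes-on-linComb φ ((a , w) ∷ cs) (φw≈0 ∷ φcs≈0) = begin
    eval φ (linComb K ((a , w) ∷ cs))          ≈⟨ eval-+ φ (a ⊛ w) (linComb K cs) ⟩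
    eval φ (a ⊛ w) + eval φ (linComb K cs)     ≈⟨ +-cong (eval-* φ a w) (vanishes-on-linComb φ cs φcs≈0) ⟩
    a * eval φ w + 0#                          ≈⟨ +-cong (*-congˡ φw≈0) refl ⟩
    a * 0# + 0#                                ≈⟨ +-identityʳ _ ⟩
    a * 0#                                     ≈⟨ zeroʳ a ⟩
    0#                                         ∎

  V : ℕ → Set c
  V n = Vect (Fin n)

  unit : ∀ {n} → Fin n → V n
  unit zero    = 1# ∷ᵛ 0ᵛ
  unit (suc j) = 0# ∷ᵛ unit j

  prepend-zero-linear : ∀ {n} → IsLinear {Fin (ℕ.suc n)} {Fin n} (0# ∷ᵛ_)
  prepend-zero-linear = record
    { map-cong = λ { eq zero → refl ; eq (suc i) → eq i }
    ; map-+    = λ { x y zero → sym (+-identityʳ 0#) ; x y (suc i) → refl }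
    ; map-*    = λ { a x zero → sym (zeroʳ a) ; a x (suc i) → refl }
    }

  decomposition : ∀ {n} (φ : Form (Fin n)) (x : V n) → eval φ x ≈ sum (λ j → eval φ (unit j) * x j)
  decomposition {ℕ.zero}  φ x = trans (eval-cong φ (λ ())) (eval-0 φ)
  decomposition {ℕ.suc n} φ x = begin
    eval φ x                                                 ≈⟨ eval-cong φ split ⟩
    eval φ ((x zero ⊛ unit zero) ⊕ (0# ∷ᵛ tail x))           ≈⟨ eval-+ φ _ _ ⟩
    eval φ (x zero ⊛ unit zero) + eval φ′ (tail x)           ≈⟨ +-cong (eval-* φ _ _) (decomposition φ′ (tail x)) ⟩
    x zero * eval φ (unit zero) + sum (λ j → eval φ′ (unit j) * x (suc j))
                                                             ≈⟨ +-cong (*-comm _ _) refl ⟩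
    sum (λ j → eval φ (unit j) * x j)                        ∎
    where
      φ′ : Form (Fin n)
      φ′ = pullback (0# ∷ᵛ_) prepend-zero-linear φ
      split : x ≋ ((x zero ⊛ unit zero) ⊕ (0# ∷ᵛ tail x))
      split zero    = sym (trans (+-identityʳ _) (*-identityʳ _))
      split (suc i) = sym (trans (+-cong (zeroʳ _) refl) (+-identityˡ _))

  zero-or-nonzero-coordinate : ∀ {n} (x : V n) → ¬ ¬ (x ≋ 0ᵛ ⊎ ∃ λ j → ¬ x j ≈ 0#)
  zero-or-nonzero-coordinate {n} x = ¬¬-map decide (sequence¬¬ (λ j → ¬¬-excluded-middle))
    where
      decide : (∀ j → Dec (x j ≈ 0#)) → x ≋ 0ᵛ ⊎ ∃ λ j → ¬ x j ≈ 0#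
      decide x≈0? with all? x≈0?
      ... | yes x≈0 = inj₁ x≈0
      ... | no x≉0  = inj₂ (¬∀⟶∃¬ n _ x≈0? x≉0)

  -- Gaussian elimination along u with pivot j (c = u_j⁻¹):
  -- x ↦ x - (x_j c) u kills u, maps a subspace containing u into itself,
  -- and x is recovered as eliminate x + (x_j c) u.
  eliminate : ∀ {n} → Fin n → Carrier → V n → V n → V n
  eliminate j c u x = x ⊕ ((- (x j * c)) ⊛ u)

  eliminate-linear : ∀ {n} j c (u : V n) → IsLinear (eliminate j c u)
  eliminate-linear j c u = record
    { map-cong = λ eq i → +-cong (eq i) (*-congʳ (-‿cong (*-congʳ (eq j))))
    ; map-+    = λ x y i → elim-+ (x i) (y i) (x j) (y j) c (u i)
    ; map-*    = λ a x i → elim-* a (x i) (x j) c (u i)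
    }

  eliminate-pivot : ∀ {n} j c (u : V n) → u j * c ≈ 1# → eliminate j c u u ≋ 0ᵛ
  eliminate-pivot j c u ujc≈1 i =
    trans (+-congˡ (*-congʳ (-‿cong ujc≈1))) (elim-self (u i))

  eliminate-restore : ∀ {n} j c (u x : V n) → x ≋ (eliminate j c u x ⊕ ((x j * c) ⊛ u))
  eliminate-restore j c u x i = elim-restore (x i) (x j * c) (u i)

  Separates : ∀ {n} → Form (Fin n) → List (V n) → V n → Set (c ⊔ ℓ)
  Separates φ gs z = All (λ g → eval φ g ≈ 0#) gs × eval φ z ≈ 1#

  Separable : ∀ {n} → List (V n) → V n → Set (c ⊔ ℓ)
  Separable gs z = Σ (Form (Fin _)) λ φ → Separates φ gs z

  -- Induction on the length of the list, eliminating one vector at a time.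
  module Separation {p n} (U : Subspace K p n) where
    open Subspace U

    separate-by-length : ∀ m (gs : List (V n)) → length gs ≡ m → All _∈U gs →
                         ∀ z → ¬ z ∈U → ¬ ¬ Separable gs z
    separate-by-length _ [] _ [] z z∉U = ¬¬-map separating-coordinate (zero-or-nonzero-coordinate z)
      where
        separating-coordinate : z ≋ 0ᵛ ⊎ (∃ λ j → ¬ z j ≈ 0#) → Separable [] z
        separating-coordinate (inj₁ z≈0) = ⊥-elim (z∉U (resp (sym ∘ z≈0) zero∈))
        separating-coordinate (inj₂ (j , zj≉0)) =
          let (c , zjc≈1) = inverse (z j) zj≉0
          in c • coordinate j , [] , trans (*-comm c (z j)) zjc≈1
    separate-by-length (ℕ.suc m) (u ∷ gs) len (u∈U ∷ gs⊆U) z z∉U =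
      bind¬¬ (zero-or-nonzero-coordinate u) λ where
        (inj₁ u≈0) → ¬¬-map (also-vanishes-at-zero u≈0)
                            (separate-by-length m gs (suc-injective len) gs⊆U z z∉U)
        (inj₂ (j , uj≉0)) →
          let (c , ujc≈1) = inverse (u j) uj≉0
              π = eliminate j c u
              πgs⊆U = map⁺ (All.map (λ g∈U → +∈ g∈U (*∈ _ u∈U)) gs⊆U)
              πz∉U = λ πz∈U → z∉U (resp (λ i → sym (eliminate-restore j c u z i))
                                        (+∈ πz∈U (*∈ (z j * c) u∈U)))
          in ¬¬-map (pull-back-along-elimination j c ujc≈1)
                    (separate-by-length m (map π gs) (≡.trans (length-map π gs) (suc-injective len))
                                        πgs⊆U (π z) πz∉U)
      where
        also-vanishes-at-zero : u ≋ 0ᵛ → Separable gs z → Separable (u ∷ gs) z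
        also-vanishes-at-zero u≈0 (φ , φgs≈0 , φz≈1) =
          φ , trans (eval-cong φ u≈0) (eval-0 φ) ∷ φgs≈0 , φz≈1

        pull-back-along-elimination : ∀ j c → u j * c ≈ 1# →
          Separable (map (eliminate j c u) gs) (eliminate j c u z) → Separable (u ∷ gs) z
        pull-back-along-elimination j c ujc≈1 (φ , φπgs≈0 , φπz≈1) =
          pullback (eliminate j c u) (eliminate-linear j c u) φ ,
          trans (eval-cong φ (eliminate-pivot j c u ujc≈1)) (eval-0 φ) ∷ map⁻ φπgs≈0 ,
          φπz≈1

    separate : (gs : List (V n)) → All _∈U gs → ∀ z → ¬ z ∈U → ¬ ¬ Separable gs z
    separate gs = separate-by-length (length gs) gs ≡.refl

  prod-cong : ∀ {n} {f g : Fin n → Carrier} → (∀ i → f i ≈ g i) → prod K f ≈ prod K g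
  prod-cong {ℕ.zero}  f≈g = refl
  prod-cong {ℕ.suc n} f≈g = *-cong (f≈g zero) (prod-cong (f≈g ∘ suc))

  prod-ones : ∀ {n} → prod K {n} (λ _ → 1#) ≈ 1#
  prod-ones {ℕ.zero}  = refl
  prod-ones {ℕ.suc n} = trans (*-identityˡ _) (prod-ones {n})

  prod-zero-factor : ∀ {n} (f : Fin n → Carrier) i → f i ≈ 0# → prod K f ≈ 0#
  prod-zero-factor f zero    fi≈0 = trans (*-congʳ fi≈0) (zeroˡ _)
  prod-zero-factor f (suc i) fi≈0 = trans (*-congˡ (prod-zero-factor (f ∘ suc) i fi≈0)) (zeroʳ _)

  monomial-raise : ∀ {n d} (x : V n) j (α : Multi n d) →
                   veronese K (ℕ.suc d) x (raise j α) ≈ x j * veronese K d x α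
  monomial-raise x zero    (a , _) = *-assoc _ _ _
  monomial-raise x (suc j) (a , _) =
    trans (*-congˡ (monomial-raise (tail x) j (tail a , ≡.refl))) (x∙yz≈y∙xz _ _ _)

  productForm : ∀ {n} d → (Fin d → Form (Fin n)) → Form (Multi n d)
  productForm ℕ.zero    ψ = coordinate zeroExponent
  productForm (ℕ.suc d) ψ = ∑ᶠ λ j →
    eval (ψ zero) (unit j) • pullback (_∘ raise j) (reindex-linear (raise j)) (productForm d (ψ ∘ suc))

  productForm-veronese : ∀ {n} d (ψ : Fin d → Form (Fin n)) (x : V n) →
                         eval (productForm d ψ) (veronese K d x) ≈ prod K (λ k → eval (ψ k) x)
  productForm-veronese {n} ℕ.zero    ψ x = prod-ones {n}
  productForm-veronese {n} (ℕ.suc d) ψ x = begin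
    sum (λ j → a j * eval Φ′ (veronese K (ℕ.suc d) x ∘ raise j))
      ≈⟨ sum-cong-≋ {n} (λ j → *-congˡ (raised j)) ⟩
    sum (λ j → a j * (x j * R))  ≈⟨ sum-cong-≋ {n} (λ j → sym (*-assoc (a j) (x j) R)) ⟩
    sum (λ j → (a j * x j) * R)  ≈⟨ sym (*-distribʳ-sum R (λ j → a j * x j)) ⟩
    sum (λ j → a j * x j) * R    ≈⟨ *-congʳ (sym (decomposition (ψ zero) x)) ⟩
    eval (ψ zero) x * R          ∎
    where
      a : Fin n → Carrier
      a j = eval (ψ zero) (unit j)
      Φ′ : Form (Multi n d)
      Φ′ = productForm d (ψ ∘ suc)
      R : Carrier
      R = prod K (λ k → eval (ψ (suc k)) x)
      raised : ∀ j → eval Φ′ (veronese K (ℕ.suc d) x ∘ raise j) ≈ x j * R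
      raised j = begin
        eval Φ′ (veronese K (ℕ.suc d) x ∘ raise j) ≈⟨ eval-cong Φ′ (monomial-raise x j) ⟩
        eval Φ′ (x j ⊛ veronese K d x)             ≈⟨ eval-* Φ′ (x j) _ ⟩
        x j * eval Φ′ (veronese K d x)             ≈⟨ *-congˡ (productForm-veronese d (ψ ∘ suc) x) ⟩
        x j * R                                    ∎

  -- For each i we
  -- list the vectors u_k ∈ U_i with w_k = v_d(u_k); terms coming from
  -- other subspaces are replaced by 0 ∈ U_i, keeping the list aligned.
  module Terms {p d n} (U : Fin d → Subspace K p n) where
    _∈_ : V n → Fin d → Set p
    u ∈ i = Subspace._∈U (U i) u

    InUnion : VecN K n d → Set (c ⊔ ℓ ⊔ p)
    InUnion w = ∃ λ i → VeroneseImage K d (U i) w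

    onlyIf : Fin d → Fin d → V n → V n
    onlyIf i′ i u with i′ ≟ i
    ... | yes _ = u
    ... | no _  = 0ᵛ

    onlyIf-∈ : ∀ i′ i {u} → u ∈ i′ → onlyIf i′ i u ∈ i
    onlyIf-∈ i′ i u∈i′ with i′ ≟ i
    ... | yes ≡.refl = u∈i′
    ... | no _       = Subspace.zero∈ (U i)

    onlyIf-diag : ∀ i u → onlyIf i i u ≡ u
    onlyIf-diag i u with i ≟ i
    ... | yes _  = ≡.refl
    ... | no i≢i = ⊥-elim (i≢i ≡.refl)

    witnessesIn : ∀ i {cs : List (Carrier × VecN K n d)} → All (InUnion ∘ proj₂) cs → List (V n)
    witnessesIn i []                     = []
    witnessesIn i ((i′ , u , _) ∷ terms) = onlyIf i′ i u ∷ witnessesIn i terms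

    witnesses-∈ : ∀ i {cs} (terms : All (InUnion ∘ proj₂) cs) → All (_∈ i) (witnessesIn i terms)
    witnesses-∈ i []                            = []
    witnesses-∈ i ((i′ , u , u∈i′ , _) ∷ terms) = onlyIf-∈ i′ i u∈i′ ∷ witnesses-∈ i terms

    -- If each ψ_i vanishes on the witnesses in U_i, the product form
    -- vanishes on every term: Φ(v_d(u)) = ∏_k ψ_k(u) has the factor ψ_i(u) = 0.
    productForm-vanishes : (ψ : Fin d → Form (Fin n)) {cs : List (Carrier × VecN K n d)}
      (terms : All (InUnion ∘ proj₂) cs) →
      (∀ i → All (λ g → eval (ψ i) g ≈ 0#) (witnessesIn i terms)) →
      All (λ cw → eval (productForm d ψ) (proj₂ cw) ≈ 0#) cs
    productForm-vanishes ψ []                                          _   = []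
    productForm-vanishes ψ {(_ , w) ∷ _} ((i , u , _ , w≈vu) ∷ terms) ψ≈0 =
      Φw≈0 ∷ productForm-vanishes ψ terms (All.tail ∘ ψ≈0)
      where
        ψᵢu≈0 : eval (ψ i) u ≈ 0#
        ψᵢu≈0 = subst (λ v → eval (ψ i) v ≈ 0#) (onlyIf-diag i u) (All.head (ψ≈0 i))
        Φw≈0 : eval (productForm d ψ) w ≈ 0#
        Φw≈0 = trans (eval-cong (productForm d ψ) w≈vu)
                     (trans (productForm-veronese d ψ u)
                            (prod-zero-factor (λ k → eval (ψ k) u) i ψᵢu≈0))

-- The theorem.
lemma2p1 : ∀ {c ℓ p : Level} (K : Field c ℓ) (d n : ℕ) → 2 ≤ d → 2 ≤ n →
    (U : Fin d → Subspace K p n) (z : Vecᴷ K n) →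
    (∀ i → ¬ Subspace._∈U (U i) z) →
    ¬ InSpan K (λ w → ∃ λ i → VeroneseImage K d (U i) w) (veronese K d z)
lemma2p1 K d n _ _ U z z∉U (cs , terms , vz≈Σ) =
  sequence¬¬ (λ i → separate (U i) (witnessesIn i terms) (witnesses-∈ i terms) z (z∉U i)) λ seps →
    let ψ : Fin d → Form (Fin n)
        ψ i = proj₁ (seps i)
        Φ : Form (Multi n d)
        Φ = productForm d ψ
    in 1≉0 (begin
      1#                              ≈⟨ sym (prod-ones {d}) ⟩
      prod K {d} (λ _ → 1#)           ≈⟨ prod-cong {d} (λ i → sym (proj₂ (proj₂ (seps i)))) ⟩
      prod K (λ i → eval (ψ i) z)     ≈⟨ sym (productForm-veronese d ψ z) ⟩
      eval Φ (veronese K d z)         ≈⟨ eval-cong Φ vz≈Σ ⟩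
      eval Φ (linComb K cs)           ≈⟨ vanishes-on-linComb Φ cs
                                           (productForm-vanishes ψ terms (λ i → proj₁ (proj₂ (seps i)))) ⟩
      0#                              ∎)
  where
    open Field K using (1≉0; 0#; 1#; sym; setoid)
    open SetoidReasoning setoid
    open LinearAlgebra K
    open Form
    open Separation using (separate)
    open Terms U
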